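{- Let $D$ be a delta-matroid on $[n,\overline n]$. The independent sets $I$ of $D$ with $a(I)=0$ form a simplicial complex on $[n,\overline n]$ (i.e. if $I$ is independent with $a(I)=0$ and $J\subseteq I$, then $a(J)=0$).
   Context: Let $[n,\overline{n}]=\{1,\dots,n,\overline{1},\dots,\overline{n}\}$ with involution $a\mapsto\overline a$. For $E\subseteq[n]$, a subset of $E\cup\overline E$ is admissible if it contains at most one of $i,\overline i$ for each $i$; a delta-matroid on $E\cup\overline E$ is a non-empty collection $\mathcal F$ of admissible subsets of size $|E|$ (feasible sets) such that $\operatorname{Conv}\{e_B:B\in\mathcal F\}\subseteq\mathbb{R}^E$ has all edges parallel to some $e_i$ or $e_i\pm e_j$ ($e_{\overline i}=-e_i$, $e_S=\sum_{a\in S}e_a$). For $A\subseteq[n]$, the projection $D(A)$ has feasible sets $B\setminus(A\cup\overline A)$, $B\in\mathcal F$. An admissible set $I$ is independent in $D$ if contained in a feasible set. Order $[n]$ by $1<\dots<n$. For a feasible set $B$ of a delta-matroid $D'$, $i$ is $B$-orientable if $B\,\Delta\,\{i,\overline i\}$ is not feasible in $D'$, and $B$-active if it is $B$-orientable and there is no $j<i$ with $B\,\Delta\,\{i,j,\overline i,\overline j\}$ feasible in $D'$ ($\Delta$ = symmetric difference). For $I$ independent in $D$, let $\underline I=\{i\in[n]:i\in I\text{ or }\overline i\in I\}$; $I$ is feasible in $D([n]\setminus\underline I)$, and $i\in\underline I$ is $I$-active if it is $I$-active in $D([n]\setminus\underline I)$. $a(I)$ is the number of $I$-active elements of $\underline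 I$. -}

module Defs where

open import Data.Nat using (ℕ; _+_)
open import Data.Integer as ℤ using (ℤ; 0ℤ; 1ℤ)
open import Data.Bool using (Bool; true; false; _xor_; _∧_; _∨_; not; if_then_else_; T)
open import Data.Fin using (Fin; _<_; _<?_)
open import Data.Fin.Properties using () renaming (any? to anyFin?)
open import Data.Fin.Subset using (Subset; _∪_; _─_; ∣_∣; ⁅_⁆; ∁; ⊥) renaming (_⊆_ to _⊆ˢ_)
open import Data.Vec using (Vec; []; _∷_; lookup; tabulate; zipWith; foldr)
import Data.Vec
import Data.Vec.Properties as VecP
open import Data.List using (List; [])
open import Data.List.Membership.Propositional using (_∈_)
open import Data.List.Relation.Unary.All using (All)
open import Data.List.Relation.Unary.Any using (Any; any?)
open import Data.Product using (_×_; _,_; ∃; ∃-syntax; Σ-syntax; proj₁; proj₂)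
open import Data.Product.Properties using (≡-dec)
open import Data.Sum using (_⊎_)
open import Relation.Nullary using (¬_; Dec; yes; no; ¬?; _×-dec_)
open import Relation.Nullary.Decidable using (⌊_⌋)
open import Relation.Binary.PropositionalEquality using (_≡_; _≢_)
import Data.Bool.Properties as BoolP

-- Subsets of [n, n̄] = {1..n, 1̄..n̄}.
-- A subset S is a pair (P , N) of subsets of [n]:
--   P = { i | i ∈ S },  N = { i | ī ∈ S }.

SSet : ℕ → Set
SSet n = Subset n × Subset n

module _ {n : ℕ} where

  _∈⁺_ : Fin n → SSet n → Bool
  i ∈⁺ S = lookup (proj₁ S) i

  _∈⁻_ : Fin n → SSet n → Bool
  i ∈⁻ S = lookup (proj₂ S) i

  _⊆_ : SSet n → SSet n → Set
  S ⊆ T = (proj₁ S ⊆ˢ proj₁ T) × (proj₂ S ⊆ˢ proj₂ T)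

  size : SSet n → ℕ
  size S = ∣ proj₁ S ∣ + ∣ proj₂ S ∣

  _Δ_ : SSet n → SSet n → SSet n
  S Δ T = zipWith _xor_ (proj₁ S) (proj₁ T) , zipWith _xor_ (proj₂ S) (proj₂ T)

  _∖±_ : SSet n → Subset n → SSet n
  S ∖± A = (proj₁ S ─ A) , (proj₂ S ─ A)

  pair : Fin n → SSet n
  pair i = ⁅ i ⁆ , ⁅ i ⁆

  quad : Fin n → Fin n → SSet n
  quad i j = (⁅ i ⁆ ∪ ⁅ j ⁆) , (⁅ i ⁆ ∪ ⁅ j ⁆)

  Admissible : SSet n → Set
  Admissible S = ∀ (i : Fin n) → (i ∈⁺ S) ∧ (i ∈⁻ S) ≡ false

  under : SSet n → Subset n
  under S = zipWith _∨_ (proj₁ S) (proj₂ S)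

  ind : Bool → ℤ
  ind true  = 1ℤ
  ind false = 0ℤ

  e : SSet n → Vec ℤ n
  e S = tabulate (λ i → ind (i ∈⁺ S) ℤ.- ind (i ∈⁻ S))

  unit : Fin n → Vec ℤ n
  unit i = tabulate (λ k → ind (lookup ⁅ i ⁆ k))

  _-ᵥ_ : Vec ℤ n → Vec ℤ n → Vec ℤ n
  u -ᵥ v = zipWith ℤ._-_ u v

  _+ᵥ_ : Vec ℤ n → Vec ℤ n → Vec ℤ n
  u +ᵥ v = zipWith ℤ._+_ u v

  _·ᵥ_ : ℤ → Vec ℤ n → Vec ℤ n
  c ·ᵥ v = Data.Vec.map (c ℤ.*_) v

  dot : Vec ℤ n → Vec ℤ n → ℤ
  dot u v = foldr (λ _ → ℤ) ℤ._+_ 0ℤ (zipWith ℤ._*_ u v)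

  ParallelToRoot : Vec ℤ n → Set
  ParallelToRoot d =
    (∃[ c ] ∃[ i ] d ≡ c ·ᵥ unit i)
    ⊎ (∃[ c ] ∃[ i ] ∃[ j ] (i ≢ j × (d ≡ c ·ᵥ (unit i +ᵥ unit j) ⊎ d ≡ c ·ᵥ (unit i -ᵥ unit j))))

  -- [e_u, e_v] (with e_u ≠ e_v) is an edge of Conv{e_B : B ∈ F}:
  -- it is the face exposed by some linear functional w, i.e. the points of F
  -- maximising ⟨w, -⟩ are exactly e_u and e_v.
  IsEdge : List (SSet n) → SSet n → SSet n → Set
  IsEdge F u v =
    u ∈ F × v ∈ F × e u ≢ e v ×
    (∃[ w ] ( dot w (e u) ≡ dot w (e v)
            × (∀ x → x ∈ F → dot w (e x) ℤ.≤ dot w (e u))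
            × (∀ x → x ∈ F → dot w (e x) ≡ dot w (e u) → e x ≡ e u ⊎ e x ≡ e v)))

record DeltaMatroid (n : ℕ) : Set where
  field
    feasible   : List (SSet n)
    nonempty   : feasible ≢ []
    admissible : All Admissible feasible
    sizeN      : All (λ B → size B ≡ n) feasible
    edges      : ∀ u v → IsEdge feasible u v → ParallelToRoot (e u -ᵥ e v)

module _ {n : ℕ} (D : DeltaMatroid n) where
  open DeltaMatroid D

  -- S is feasible in the projection D(A): S = B ∖ (A ∪ Ā) for some feasible B
  FeasibleIn : Subset n → SSet n → Set
  FeasibleIn A S = Any (λ B → S ≡ B ∖± A) feasible

  _≟ˢ_ : (S T : SSet n) → Dec (S ≡ T)
  _≟ˢ_ = ≡-dec (VecP.≡-dec BoolP._≟_) (VecP.≡-dec BoolP._≟_)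

  feasibleIn? : ∀ A S → Dec (FeasibleIn A S)
  feasibleIn? A S = any? (λ B → S ≟ˢ (B ∖± A)) feasible

  Independent : SSet n → Set
  Independent I = Admissible I × Any (λ B → I ⊆ B) feasible

  Orientable : Subset n → SSet n → Fin n → Set
  Orientable A B i = ¬ FeasibleIn A (B Δ pair i)

  Active : Subset n → SSet n → Fin n → Set
  Active A B i = Orientable A B i × ¬ (∃[ j ] (j < i × FeasibleIn A (B Δ quad i j)))

  active? : ∀ A B i → Dec (Active A B i)
  active? A B i =
    ¬? (feasibleIn? A (B Δ pair i))
    ×-dec ¬? (anyFin? (λ j → (j <? i) ×-dec feasibleIn? A (B Δ quad i j)))

  IActive : SSet n → Fin n → Set
  IActive I i = T (lookup (under I) i) × Active (∁ (under I)) I i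

  a : SSet n → ℕ
  a I = ∣ tabulate (λ i → lookup (under I) i ∧ ⌊ active? (∁ (under I)) I i ⌋) ∣

{-# OPTIONS --safe #-}
-- For J ⊆ I every J-active element is I-active, so a is monotone and a(I) = 0 forces a(J) = 0.
-- Admissibility of I gives I ∖ (∁J ∪ ∁J̄) = J, so deleting the elements outside J maps a
-- feasible set I Δ {i, ī} or I Δ {i, j, ī, j̄} (j < i) of D(∁I), which shows that i is not
-- I-active, to a feasible set J Δ {i, ī} or J Δ {i, j, ī, j̄} of D(∁J); when j ∉ J the latter
-- collapses to J Δ {i, ī}, and either way i is not J-active.
module Submission where

open import Defs
open import Data.Nat using (ℕ; _≤_)
open import Data.Nat.Properties using (n≤0⇒n≡0)
open import Data.Bool using (true; false; _xor_; _∧_)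
open import Data.Bool.Properties using (T-≡; T-∧)
open import Data.Empty using (⊥-elim)
open import Data.Fin using (Fin; _<_)
open import Data.Fin.Subset
  using (Subset; _∈_; _∉_; _∪_; _─_; ⁅_⁆; ∁; ⊥; inside; outside)
  renaming (_⊆_ to _⊆ˢ_)
open import Data.Fin.Subset.Properties
  using ( ⊆-antisym; ⊆-trans; _∈?_; drop-there; x∈⁅y⁆⇒x≡y; Empty-unique; p─q⊆p
        ; x∈p∧x∉q⇒x∈p─q; p─q─r≡p─q∪r; p⊆p∪q; q⊆p∪q; x∈p∪q⁻; x∈p∪q⁺
        ; x∈p⇒x∉∁p; x∉p⇒x∈∁p; x∉∁p⇒x∈p; p⊆q⇒∁p⊇∁q; p⊆q⇒∣p∣≤∣q∣
        ; ∪-comm; ∪-identityʳ )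
open import Data.Vec using ([]; _∷_; here; there; lookup; tabulate; zipWith)
open import Data.Vec.Properties using (lookup∘tabulate; []=⇒lookup; lookup⇒[]=)
open import Data.List.Relation.Unary.Any as Any using ()
open import Data.Product using (_×_; _,_; proj₁; proj₂; ∃-syntax)
open import Data.Sum using ([_,_]′; inj₁; inj₂)
open import Function using (id; _∘_; flip)
open import Function.Bundles using (Equivalence)
open import Relation.Nullary using (¬_; yes; no)
open import Relation.Nullary.Decidable using (⌊_⌋; toWitness; fromWitness)
open import Relation.Binary.PropositionalEquality using (_≡_; refl; sym; trans; cong; cong₂; subst)

private
  variable
    n : ℕ
    x i j : Fin n
    p q r p′ q′ : Subset n

x∈p─q⇒x∉q : ∀ (p q : Subset n) → x ∈ p ─ q → x ∉ q
x∈p─q⇒x∉q (_ ∷ p) (outside ∷ q) here      = λ ()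
x∈p─q⇒x∉q (_ ∷ p) (_ ∷ q)       (there x∈) = x∈p─q⇒x∉q p q x∈ ∘ drop-there

─-distribʳ-xor : ∀ (p q r : Subset n) →
  zipWith _xor_ p q ─ r ≡ zipWith _xor_ (p ─ r) (q ─ r)
─-distribʳ-xor []      []      []            = refl
─-distribʳ-xor (x ∷ p) (y ∷ q) (inside ∷ r)  = cong (outside ∷_) (─-distribʳ-xor p q r)
─-distribʳ-xor (x ∷ p) (y ∷ q) (outside ∷ r) = cong ((x xor y) ∷_) (─-distribʳ-xor p q r)

─-distribʳ-∪ : ∀ (p q r : Subset n) → (p ∪ q) ─ r ≡ (p ─ r) ∪ (q ─ r)
─-distribʳ-∪ []      []      []            = refl
─-distribʳ-∪ (x ∷ p) (y ∷ q) (inside ∷ r)  = cong (outside ∷_) (─-distribʳ-∪ p q r)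
─-distribʳ-∪ (x ∷ p) (y ∷ q) (outside ∷ r) = cong (_ ∷_) (─-distribʳ-∪ p q r)

p⊆q⇒p∪q≡q : p ⊆ˢ q → p ∪ q ≡ q
p⊆q⇒p∪q≡q {p = p} {q} p⊆q = ⊆-antisym (λ x∈ → [ p⊆q , id ]′ (x∈p∪q⁻ p q x∈)) (q⊆p∪q p q)

p⊆q⇒r─p─q≡r─q : p ⊆ˢ q → r ─ p ─ q ≡ r ─ q
p⊆q⇒r─p─q≡r─q {p = p} {q} {r} p⊆q = trans (p─q─r≡p─q∪r r p q) (cong (r ─_) (p⊆q⇒p∪q≡q p⊆q))

x∉p⇒⁅x⁆─p≡⁅x⁆ : x ∉ p → ⁅ x ⁆ ─ p ≡ ⁅ x ⁆
x∉p⇒⁅x⁆─p≡⁅x⁆ {x = x} {p} x∉p = ⊆-antisym (p─q⊆p ⁅ x ⁆ p) ⁅x⁆⊆⁅x⁆─p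
  where
  ⁅x⁆⊆⁅x⁆─p : ⁅ x ⁆ ⊆ˢ ⁅ x ⁆ ─ p
  ⁅x⁆⊆⁅x⁆─p y∈⁅x⁆ with refl ← x∈⁅y⁆⇒x≡y x y∈⁅x⁆ = x∈p∧x∉q⇒x∈p─q y∈⁅x⁆ x∉p

x∈p⇒⁅x⁆─p≡⊥ : x ∈ p → ⁅ x ⁆ ─ p ≡ ⊥
x∈p⇒⁅x⁆─p≡⊥ {x = x} {p} x∈p = Empty-unique λ (y , y∈) →
  x∈p─q⇒x∉q ⁅ x ⁆ p y∈ (subst (_∈ p) (sym (x∈⁅y⁆⇒x≡y x (p─q⊆p ⁅ x ⁆ p y∈))) x∈p)

disjoint⇒p─∁[p′∪q′]≡p′ : (∀ {x} → x ∈ p → x ∉ q) → p′ ⊆ˢ p → q′ ⊆ˢ q → p ─ ∁ (p′ ∪ q′) ≡ p′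
disjoint⇒p─∁[p′∪q′]≡p′ {p = p} {q} {p′} {q′} disjoint p′⊆p q′⊆q = ⊆-antisym ⊆p′ ⊇p′
  where
  ⊆p′ : p ─ ∁ (p′ ∪ q′) ⊆ˢ p′
  ⊆p′ x∈ with x∈p∪q⁻ p′ q′ (x∉∁p⇒x∈p (x∈p─q⇒x∉q p _ x∈))
  ... | inj₁ x∈p′ = x∈p′
  ... | inj₂ x∈q′ = ⊥-elim (disjoint (p─q⊆p p _ x∈) (q′⊆q x∈q′))
  ⊇p′ : p′ ⊆ˢ p ─ ∁ (p′ ∪ q′)
  ⊇p′ x∈p′ = x∈p∧x∉q⇒x∈p─q (p′⊆p x∈p′) (x∈p⇒x∉∁p (p⊆p∪q q′ x∈p′))

module _ {A : Subset n} where

  ∖±-distrib-Δ : ∀ (S T : SSet n) → (S Δ T) ∖± A ≡ (S ∖± A) Δ (T ∖± A)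
  ∖±-distrib-Δ (p , q) (p′ , q′) = cong₂ _,_ (─-distribʳ-xor p p′ A) (─-distribʳ-xor q q′ A)

  ∖±-absorb : ∀ {A′} → A ⊆ˢ A′ → ∀ (S : SSet n) → (S ∖± A) ∖± A′ ≡ S ∖± A′
  ∖±-absorb A⊆A′ _ = cong₂ _,_ (p⊆q⇒r─p─q≡r─q A⊆A′) (p⊆q⇒r─p─q≡r─q A⊆A′)

  pair-∖± : i ∉ A → pair i ∖± A ≡ pair i
  pair-∖± i∉A = cong₂ _,_ (x∉p⇒⁅x⁆─p≡⁅x⁆ i∉A) (x∉p⇒⁅x⁆─p≡⁅x⁆ i∉A)

  quad-∖±-∉ : i ∉ A → j ∉ A → quad i j ∖± A ≡ quad i j
  quad-∖±-∉ {i} {j} i∉A j∉A = cong₂ _,_ ⁅i,j⁆─A≡⁅i,j⁆ ⁅i,j⁆─A≡⁅i,j⁆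
    where
    ⁅i,j⁆─A≡⁅i,j⁆ : (⁅ i ⁆ ∪ ⁅ j ⁆) ─ A ≡ ⁅ i ⁆ ∪ ⁅ j ⁆
    ⁅i,j⁆─A≡⁅i,j⁆ = trans (─-distribʳ-∪ ⁅ i ⁆ ⁅ j ⁆ A)
                          (cong₂ _∪_ (x∉p⇒⁅x⁆─p≡⁅x⁆ i∉A) (x∉p⇒⁅x⁆─p≡⁅x⁆ j∉A))

  quad-∖±-∈ : i ∉ A → j ∈ A → quad i j ∖± A ≡ pair i
  quad-∖±-∈ {i} {j} i∉A j∈A = cong₂ _,_ ⁅i,j⁆─A≡⁅i⁆ ⁅i,j⁆─A≡⁅i⁆
    where
    ⁅i,j⁆─A≡⁅i⁆ : (⁅ i ⁆ ∪ ⁅ j ⁆) ─ A ≡ ⁅ i ⁆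
    ⁅i,j⁆─A≡⁅i⁆ = trans (─-distribʳ-∪ ⁅ i ⁆ ⁅ j ⁆ A)
                        (trans (cong₂ _∪_ (x∉p⇒⁅x⁆─p≡⁅x⁆ i∉A) (x∈p⇒⁅x⁆─p≡⊥ j∈A))
                               (∪-identityʳ ⁅ i ⁆))

⊆±-trans : ∀ {S T U : SSet n} → S ⊆ T → T ⊆ U → S ⊆ U
⊆±-trans (S⊆T⁺ , S⊆T⁻) (T⊆U⁺ , T⊆U⁻) = ⊆-trans S⊆T⁺ T⊆U⁺ , ⊆-trans S⊆T⁻ T⊆U⁻

admissible⇒disjoint : ∀ {S : SSet n} → Admissible S → x ∈ proj₁ S → x ∉ proj₂ S
admissible⇒disjoint {x = x} adm x∈⁺ x∈⁻ with adm x
... | both≡false rewrite []=⇒lookup x∈⁺ | []=⇒lookup x∈⁻ with () ← both≡false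

disjoint⇒admissible : ∀ {S : SSet n} → (∀ {x} → x ∈ proj₁ S → x ∉ proj₂ S) → Admissible S
disjoint⇒admissible {S = S} disjoint x with lookup (proj₁ S) x in e⁺ | lookup (proj₂ S) x in e⁻
... | true  | true  = ⊥-elim (disjoint (lookup⇒[]= x _ e⁺) (lookup⇒[]= x _ e⁻))
... | true  | false = refl
... | false | _     = refl

module _ {I J : SSet n} where

  Admissible-⊆ : Admissible I → J ⊆ I → Admissible J
  Admissible-⊆ admI (⊆⁺ , ⊆⁻) = disjoint⇒admissible λ x∈⁺ x∈⁻ → admissible⇒disjoint admI (⊆⁺ x∈⁺) (⊆⁻ x∈⁻)

  under-mono : J ⊆ I → under J ⊆ˢ under I
  under-mono (⊆⁺ , ⊆⁻) x∈ = [ x∈p∪q⁺ ∘ inj₁ ∘ ⊆⁺ , x∈p∪q⁺ ∘ inj₂ ∘ ⊆⁻ ]′ (x∈p∪q⁻ _ _ x∈)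

  ∖±-∁under : Admissible I → J ⊆ I → I ∖± ∁ (under J) ≡ J
  ∖±-∁under admI (⊆⁺ , ⊆⁻) = cong₂ _,_
    (disjoint⇒p─∁[p′∪q′]≡p′ (admissible⇒disjoint admI) ⊆⁺ ⊆⁻)
    (trans (cong (λ u → proj₂ I ─ ∁ u) (∪-comm (proj₁ J) (proj₂ J)))
           (disjoint⇒p─∁[p′∪q′]≡p′ (flip (admissible⇒disjoint admI)) ⊆⁻ ⊆⁺))

module _ (D : DeltaMatroid n) where

  FeasibleIn-∖± : ∀ {A A′ S} → A ⊆ˢ A′ → FeasibleIn D A S → FeasibleIn D A′ (S ∖± A′)
  FeasibleIn-∖± A⊆A′ = Any.map λ {B} S≡B∖A → trans (cong (_∖± _) S≡B∖A) (∖±-absorb A⊆A′ B)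

  module _ {I J : SSet n} (admI : Admissible I) (J⊆I : J ⊆ I) where

    FeasibleIn-restrict : ∀ Q → FeasibleIn D (∁ (under I)) (I Δ Q) →
                          FeasibleIn D (∁ (under J)) (J Δ (Q ∖± ∁ (under J)))
    FeasibleIn-restrict Q f = subst (FeasibleIn D (∁ (under J))) restrict-Δ
                                    (FeasibleIn-∖± (p⊆q⇒∁p⊇∁q (under-mono J⊆I)) f)
      where
      restrict-Δ : (I Δ Q) ∖± ∁ (under J) ≡ J Δ (Q ∖± ∁ (under J))
      restrict-Δ = trans (∖±-distrib-Δ I Q) (cong (_Δ _) (∖±-∁under admI J⊆I))

    Active-⊆ : ∀ {i} → i ∈ under J → Active D (∁ (under J)) J i → Active D (∁ (under I)) I i
    Active-⊆ {i} i∈J (orientJ , noQuadJ) = orientI , noQuadI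
      where
      i∉∁J : i ∉ ∁ (under J)
      i∉∁J = x∈p⇒x∉∁p i∈J

      orientI : Orientable D (∁ (under I)) I i
      orientI f = orientJ (subst (FeasibleIn D _) (cong (J Δ_) (pair-∖± i∉∁J))
                                 (FeasibleIn-restrict (pair i) f))

      noQuadI : ¬ (∃[ j ] (j < i × FeasibleIn D (∁ (under I)) (I Δ quad i j)))
      noQuadI (j , j<i , f) with j ∈? under J
      ... | yes j∈J = noQuadJ (j , j<i , subst (FeasibleIn D _)
                        (cong (J Δ_) (quad-∖±-∉ i∉∁J (x∈p⇒x∉∁p j∈J))) (FeasibleIn-restrict (quad i j) f))
      ... | no  j∉J = orientJ (subst (FeasibleIn D _)
                        (cong (J Δ_) (quad-∖±-∈ i∉∁J (x∉p⇒x∈∁p j∉J))) (FeasibleIn-restrict (quad i j) f))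

    IActive-⊆ : ∀ {i} → IActive D J i → IActive D I i
    IActive-⊆ {i} (T[i∈J] , act) =
      Equivalence.from T-≡ ([]=⇒lookup (under-mono J⊆I i∈J)) , Active-⊆ i∈J act
      where
      i∈J : i ∈ under J
      i∈J = lookup⇒[]= i _ (Equivalence.to T-≡ T[i∈J])

  activeSet : SSet n → Subset n
  activeSet I = tabulate (λ i → lookup (under I) i ∧ ⌊ active? D (∁ (under I)) I i ⌋)

  ∈activeSet⇒IActive : ∀ {I i} → i ∈ activeSet I → IActive D I i
  ∈activeSet⇒IActive {I} {i} i∈ with Equivalence.to T-∧ (Equivalence.from T-≡ lookup≡true)
    where
    lookup≡true : lookup (under I) i ∧ ⌊ active? D (∁ (under I)) I i ⌋ ≡ true
    lookup≡true = trans (sym (lookup∘tabulate _ i)) ([]=⇒lookup i∈)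
  ... | T[i∈I] , act = T[i∈I] , toWitness act

  IActive⇒∈activeSet : ∀ {I i} → IActive D I i → i ∈ activeSet I
  IActive⇒∈activeSet {I} {i} (T[i∈I] , act) = lookup⇒[]= i _
    (trans (lookup∘tabulate _ i) (Equivalence.to T-≡ (Equivalence.from T-∧ (T[i∈I] , fromWitness act))))

  a-mono : ∀ {I J} → Admissible I → J ⊆ I → a D J ≤ a D I
  a-mono admI J⊆I = p⊆q⇒∣p∣≤∣q∣ (IActive⇒∈activeSet ∘ IActive-⊆ admI J⊆I ∘ ∈activeSet⇒IActive)

  Independent-⊆ : ∀ {I J} → Independent D I → J ⊆ I → Independent D J
  Independent-⊆ (admI , I⊆B) J⊆I =
    Admissible-⊆ admI J⊆I , Any.map (⊆±-trans J⊆I) I⊆B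

proposition3p9 : ∀ {n : ℕ} (D : DeltaMatroid n) (I J : SSet n) →
    Independent D I → a D I ≡ 0 → J ⊆ I →
    Independent D J × a D J ≡ 0
proposition3p9 D I J indI aI≡0 J⊆I =
  Independent-⊆ D indI J⊆I , n≤0⇒n≡0 (subst (a D J ≤_) aI≡0 (a-mono D (proj₁ indI) J⊆I))
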